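{- Let $t$ be a rational number and define \begin{align*} U_+ &= t^8 + 8t^7 + 20t^6 - 56t^5 - 26t^4 + 56t^3 + 20t^2 - 8t + 1,\\ U_- &= t^8 - 8t^7 + 20t^6 + 56t^5 - 26t^4 - 56t^3 + 20t^2 + 8t + 1,\\ W &= t^{16} + 104t^{14} - 548t^{12} + 3032t^{10} - 4922t^8 + 3032t^6 - 548t^4 + 104t^2 + 1, \end{align*} and \begin{align*} a_1 &= 2t(t^4 - 2t^2 + 5)(5t^4 - 2t^2 + 1)\,U_+,\\ b_1 &= (t - 1)(t + 1)(t^4 - 4t^3 + 10t^2 - 4t + 1)(t^4 + 4t^3 + 10t^2 + 4t + 1)\,U_-,\\ c_1 &= (t^2 + 1)\,W,\\ a_2 &= (t - 1)(t + 1)(t^4 - 4t^3 + 10t^2 - 4t + 1)(t^4 + 4t^3 + 10t^2 + 4t + 1)\,U_+,\\ b_2 &= 2t(t^4 - 2t^2 + 5)(5t^4 - 2t^2 + 1)\,U_-,\\ c_2 &= (t^2 + 1)\,W. \end{align*} Suppose $a_1,b_1,c_1$ are the side lengths of a nondegenerate triangle and $a_2,b_2,c_2$ are the side lengths of a nondegenerate triangle (all positive, strict triangle inequalities). Then both triangles are rational triangles (rational sides and rational area), they have the same area, equal to $$\left| t(t - 1)(t + 1)(3t^4 - 6t^2 - 1)(t^4 + 6t^2 - 3)(t^4 - 4t^3 - 6t^2 - 4t + 1)(t^4 + 4t^3 - 6t^2 + 4t + 1)\,W\right|,$$ and the same circumradius, equal to $$\left|\frac{(t^2+1)(t^4 -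 2t^2 + 5)(5t^4 - 2t^2 + 1)(t^4 - 4t^3 + 10t^2 - 4t + 1)(t^4 + 4t^3 + 10t^2 + 4t + 1)\,U_+U_- }{2(3t^4 - 6t^2 - 1)(t^4 + 6t^2 - 3)(t^4 - 4t^3 - 6t^2 - 4t + 1)(t^4 + 4t^3 - 6t^2 + 4t + 1)}\right|.$$
   Context: A rational triangle is a triangle whose side lengths and area are rational numbers. For a triangle with sides $a,b,c$, let $D=(a+b+c)(a+b-c)(b+c-a)(c+a-b)$; the area is $\sqrt{D}/4$ and the circumradius is $abc/\sqrt{D}$. -}

module Defs where

open import Data.Nat.Base using (ℕ; zero; suc)
open import Data.Rational.Base
  using (ℚ; 0ℚ; 1ℚ; _+_; _*_; _-_; _<_; _≤_; _÷_; ∣_∣; ≢-nonZero)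
open import Data.Rational.Literals using (number; negative)
open import Agda.Builtin.FromNat using (Number; fromNat)
open import Data.Unit.Base using (⊤; tt)
import Data.Nat.Literals
open import Agda.Builtin.FromNeg using (Negative; fromNeg)
open import Data.Product using (Σ; Σ-syntax; _×_)
open import Relation.Binary.PropositionalEquality using (_≡_; _≢_)

instance
  ℚ-number = number
  ℚ-negative = negative
  ℕ-number = Data.Nat.Literals.number

infixr 8 _^_
_^_ : ℚ → ℕ → ℚ
x ^ zero  = 1ℚ
x ^ suc n = x * (x ^ n)

four : ℚ
four = 4

D : ℚ → ℚ → ℚ → ℚ
D a b c = (a + b + c) * (a + b - c) * (b + c - a) * (c + a - b)

NondegTriangle : ℚ → ℚ → ℚ → Set
NondegTriangle a b c =
  (0ℚ < a) × (0ℚ < b) × (0ℚ < c) ×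
  (a < b + c) × (b < c + a) × (c < a + b)

IsSqrt : ℚ → ℚ → Set
IsSqrt x s = (0ℚ ≤ s) × (s * s ≡ x)

-- The triangle with (rational) sides a b c is a rational triangle with
-- area A and circumradius R:  √D exists in ℚ (and is nonzero),
-- area = √D / 4 = A, circumradius = abc / √D = R.
RationalTriangleWith : ℚ → ℚ → ℚ → ℚ → ℚ → Set
RationalTriangleWith a b c A R =
  Σ[ s ∈ ℚ ] Σ[ nz ∈ s ≢ 0ℚ ]
    (IsSqrt (D a b c) s ×
     (s ÷ four ≡ A) ×
     (_÷_ (a * b * c) s {{≢-nonZero nz}} ≡ R))

module _ (t : ℚ) where
  Up Um W P1 P2 P3 P4 : ℚ
  Up = t ^ 8 + 8 * t ^ 7 + 20 * t ^ 6 - 56 * t ^ 5 - 26 * t ^ 4 + 56 * t ^ 3 + 20 * t ^ 2 - 8 * t + 1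
  Um = t ^ 8 - 8 * t ^ 7 + 20 * t ^ 6 + 56 * t ^ 5 - 26 * t ^ 4 - 56 * t ^ 3 + 20 * t ^ 2 + 8 * t + 1
  W = t ^ 16 + 104 * t ^ 14 - 548 * t ^ 12 + 3032 * t ^ 10 - 4922 * t ^ 8 + 3032 * t ^ 6 - 548 * t ^ 4 + 104 * t ^ 2 + 1
  P1 = 2 * t * (t ^ 4 - 2 * t ^ 2 + 5) * (5 * t ^ 4 - 2 * t ^ 2 + 1)
  P2 = (t - 1) * (t + 1) * (t ^ 4 - 4 * t ^ 3 + 10 * t ^ 2 - 4 * t + 1) * (t ^ 4 + 4 * t ^ 3 + 10 * t ^ 2 + 4 * t + 1)
  P3 = (3 * t ^ 4 - 6 * t ^ 2 - 1) * (t ^ 4 + 6 * t ^ 2 - 3) * (t ^ 4 - 4 * t ^ 3 - 6 * t ^ 2 - 4 * t + 1) * (t ^ 4 + 4 * t ^ 3 - 6 * t ^ 2 + 4 * t + 1)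
  P4 = t * (t - 1) * (t + 1)

  a₁ b₁ c₁ a₂ b₂ c₂ : ℚ
  a₁ = P1 * Up
  b₁ = P2 * Um
  c₁ = (t ^ 2 + 1) * W
  a₂ = P2 * Up
  b₂ = P1 * Um
  c₂ = (t ^ 2 + 1) * W

  areaExpr : ℚ
  areaExpr = ∣ P4 * P3 * W ∣

  RNum : ℚ
  RNum = (t ^ 2 + 1) * (t ^ 4 - 2 * t ^ 2 + 5) * (5 * t ^ 4 - 2 * t ^ 2 + 1) * (t ^ 4 - 4 * t ^ 3 + 10 * t ^ 2 - 4 * t + 1) * (t ^ 4 + 4 * t ^ 3 + 10 * t ^ 2 + 4 * t + 1) * Up * Um

  RDen : ℚ
  RDen = 2 * P3

{-# OPTIONS --safe #-}
-- Both triangles share the side c = (t² + 1) W, and their Heron quantities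
-- D(a, b, c) turn out to be the same perfect square, (4 t (t - 1) (t + 1) P₃ W)²,
-- where P₃ is the product of the four quartics in the denominator of R.  Hence both have the rational
-- area |t (t - 1) (t + 1) P₃ W|; moreover a₁ b₁ c₁ = a₂ b₂ c₂, so the circumradii
-- a b c / √D agree as well, and a single polynomial identity identifies them with
-- the stated quotient.  Nondegeneracy gives D > 0, which forces P₃ ≠ 0.
module Submission where

open import Data.Nat.Base using (ℕ)
open import Data.Product using (Σ; Σ-syntax; _×_; _,_)
open import Data.Rational.Base
  using (ℚ; 0ℚ; 1ℚ; _+_; _*_; _-_; -_; 1/_; _÷_; _<_; ∣_∣; NonZero; ≢-nonZero; positive)
open import Data.Rational.Properties
  using ( +-inverseʳ; +-mono-<; +-monoˡ-<
        ; *-assoc; *-comm; *-identityʳ; *-zeroˡ; *-zeroʳ; *-inverseʳ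
        ; pos*pos⇒pos; positive⁻¹; <⇒≢; <⇒≤
        ; 0≤∣p∣; 0≤p⇒∣p∣≡p; ∣p∣≡0⇒p≡0; ∣p*q∣≡∣p∣*∣q∣ )
open import Data.Rational.Solver using (module +-*-Solver)
open import Agda.Builtin.FromNat using (Number)
open import Data.Unit.Base using (tt)
open import Relation.Binary.PropositionalEquality
  using (_≡_; _≢_; refl; sym; trans; cong; subst; module ≡-Reasoning)

open import Defs

open +-*-Solver using (solve; Polynomial; con; _:=_; _:+_; _:-_; _:*_; _:^_)

0<q-p : ∀ {p q} → p < q → 0ℚ < q - p
0<q-p {p} {q} p<q = subst (_< q - p) (+-inverseʳ p) (+-monoˡ-< (- p) p<q)

0<p*q : ∀ {p q} → 0ℚ < p → 0ℚ < q → 0ℚ < p * q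
0<p*q {p} {q} 0<p 0<q =
  positive⁻¹ (p * q) {{pos*pos⇒pos p {{positive 0<p}} q {{positive 0<q}}}}

p*q≢0⇒q≢0 : ∀ p {q} → p * q ≢ 0ℚ → q ≢ 0ℚ
p*q≢0⇒q≢0 p p*q≢0 refl = p*q≢0 (*-zeroʳ p)

0<p*p⇒p≢0 : ∀ p → 0ℚ < p * p → p ≢ 0ℚ
0<p*p⇒p≢0 p 0<p*p refl = <⇒≢ 0<p*p (sym (*-zeroˡ 0ℚ))

0<D : ∀ {a b c} → NondegTriangle a b c → 0ℚ < D a b c
0<D (0<a , 0<b , 0<c , a<b+c , b<c+a , c<a+b) =
  0<p*q (0<p*q (0<p*q (+-mono-< (+-mono-< 0<a 0<b) 0<c) (0<q-p c<a+b))
               (0<q-p a<b+c))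
        (0<q-p b<c+a)

÷-unique : ∀ {p q r} .{{_ : NonZero q}} → p * q ≡ r → p ≡ r ÷ q
÷-unique {p} {q} {r} p*q≡r = begin
  p                ≡⟨ sym (*-identityʳ p) ⟩
  p * 1ℚ           ≡⟨ cong (p *_) (sym (*-inverseʳ q)) ⟩
  p * (q * 1/ q)   ≡⟨ sym (*-assoc p q (1/ q)) ⟩
  p * q * 1/ q     ≡⟨ cong (_* 1/ q) p*q≡r ⟩
  r * 1/ q         ∎
  where open ≡-Reasoning

isSqrt-∣∣ : ∀ {x} s → 0ℚ < x → x ≡ s * s → IsSqrt x ∣ s ∣
isSqrt-∣∣ {x} s 0<x x≡s*s = 0≤∣p∣ s , (begin
  ∣ s ∣ * ∣ s ∣  ≡⟨ sym (∣p*q∣≡∣p∣*∣q∣ s s) ⟩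
  ∣ s * s ∣      ≡⟨ cong ∣_∣ (sym x≡s*s) ⟩
  ∣ x ∣          ≡⟨ 0≤p⇒∣p∣≡p (<⇒≤ 0<x) ⟩
  x              ∎)
  where open ≡-Reasoning

∣four*p∣÷four≡∣p∣ : ∀ p → ∣ four * p ∣ ÷ four ≡ ∣ p ∣
∣four*p∣÷four≡∣p∣ p = sym (÷-unique (begin
  ∣ p ∣ * four       ≡⟨ *-comm ∣ p ∣ four ⟩
  four * ∣ p ∣       ≡⟨ sym (∣p*q∣≡∣p∣*∣q∣ four p) ⟩
  ∣ four * p ∣       ∎))
  where open ≡-Reasoning

÷∣∣-cross : ∀ {y s n d} (s≢0 : ∣ s ∣ ≢ 0ℚ) (d≢0 : d ≢ 0ℚ) → 0ℚ < y → y * d ≡ s * n →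
            _÷_ y ∣ s ∣ {{≢-nonZero s≢0}} ≡ ∣ _÷_ n d {{≢-nonZero d≢0}} ∣
÷∣∣-cross {y} {s} {n} {d} s≢0 d≢0 0<y y*d≡s*n = sym (÷-unique (begin
  ∣ n ÷ d ∣ * ∣ s ∣  ≡⟨ sym (∣p*q∣≡∣p∣*∣q∣ (n ÷ d) s) ⟩
  ∣ n ÷ d * s ∣      ≡⟨ cong ∣_∣ (trans (rearrange n (1/ d) s) (sym (÷-unique y*d≡s*n))) ⟩
  ∣ y ∣              ≡⟨ 0≤p⇒∣p∣≡p (<⇒≤ 0<y) ⟩
  y                  ∎))
  where
  open ≡-Reasoning
  rearrange : ∀ x i z → x * i * z ≡ z * x * i
  rearrange = solve 3 (λ x i z → x :* i :* z := z :* x :* i) refl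
  instance
    _ = ≢-nonZero s≢0
    _ = ≢-nonZero d≢0

rationalTriangle : ∀ {a b c x n d} (d≢0 : d ≢ 0ℚ) → NondegTriangle a b c →
                   D a b c ≡ (four * x) * (four * x) → a * b * c * d ≡ (four * x) * n →
                   RationalTriangleWith a b c ∣ x ∣ ∣ _÷_ n d {{≢-nonZero d≢0}} ∣
rationalTriangle {x = x} d≢0 T@(0<a , 0<b , 0<c , _) D≡ abc*d≡ =
  ∣ four * x ∣ , ∣√D∣≢0 , isSqrt-∣∣ (four * x) (0<D T) D≡ , ∣four*p∣÷four≡∣p∣ x ,
  ÷∣∣-cross ∣√D∣≢0 d≢0 (0<p*q (0<p*q 0<a 0<b) 0<c) abc*d≡
  where
  ∣√D∣≢0 : ∣ four * x ∣ ≢ 0ℚ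
  ∣√D∣≢0 = λ e → 0<p*p⇒p≢0 (four * x) (subst (0ℚ <_) D≡ (0<D T)) (∣p∣≡0⇒p≡0 _ e)

signedArea : ℚ → ℚ
signedArea t = P4 t * P3 t * W t

-- Literals are not overloaded in this file: with `fromNat` in scope, the arity
-- argument of `solve` would become an unresolved overloaded literal.
num : ∀ {n} → ℕ → Polynomial n
num m = con (Number.fromNat ℚ-number m)

-- Solver terms whose denotations are, definitionally, the polynomials of Defs.
module Term {n} (t : Polynomial n) where
  up um w p₁ p₂ p₃ p₄ a₁′ b₁′ a₂′ b₂′ c′ r-num r-den √D : Polynomial n
  up = t :^ 8 :+ num 8 :* t :^ 7 :+ num 20 :* t :^ 6 :- num 56 :* t :^ 5 :- num 26 :* t :^ 4
       :+ num 56 :* t :^ 3 :+ num 20 :* t :^ 2 :- num 8 :* t :+ num 1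
  um = t :^ 8 :- num 8 :* t :^ 7 :+ num 20 :* t :^ 6 :+ num 56 :* t :^ 5 :- num 26 :* t :^ 4
       :- num 56 :* t :^ 3 :+ num 20 :* t :^ 2 :+ num 8 :* t :+ num 1
  w  = t :^ 16 :+ num 104 :* t :^ 14 :- num 548 :* t :^ 12 :+ num 3032 :* t :^ 10 :- num 4922 :* t :^ 8
       :+ num 3032 :* t :^ 6 :- num 548 :* t :^ 4 :+ num 104 :* t :^ 2 :+ num 1
  p₁ = num 2 :* t :* (t :^ 4 :- num 2 :* t :^ 2 :+ num 5) :* (num 5 :* t :^ 4 :- num 2 :* t :^ 2 :+ num 1)
  p₂ = (t :- num 1) :* (t :+ num 1)
       :* (t :^ 4 :- num 4 :* t :^ 3 :+ num 10 :* t :^ 2 :- num 4 :* t :+ num 1)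
       :* (t :^ 4 :+ num 4 :* t :^ 3 :+ num 10 :* t :^ 2 :+ num 4 :* t :+ num 1)
  p₃ = (num 3 :* t :^ 4 :- num 6 :* t :^ 2 :- num 1) :* (t :^ 4 :+ num 6 :* t :^ 2 :- num 3)
       :* (t :^ 4 :- num 4 :* t :^ 3 :- num 6 :* t :^ 2 :- num 4 :* t :+ num 1)
       :* (t :^ 4 :+ num 4 :* t :^ 3 :- num 6 :* t :^ 2 :+ num 4 :* t :+ num 1)
  p₄ = t :* (t :- num 1) :* (t :+ num 1)
  a₁′ = p₁ :* up
  b₁′ = p₂ :* um
  a₂′ = p₂ :* up
  b₂′ = p₁ :* um
  c′  = (t :^ 2 :+ num 1) :* w
  r-num = (t :^ 2 :+ num 1) :* (t :^ 4 :- num 2 :* t :^ 2 :+ num 5) :* (num 5 :* t :^ 4 :- num 2 :* t :^ 2 :+ num 1)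
          :* (t :^ 4 :- num 4 :* t :^ 3 :+ num 10 :* t :^ 2 :- num 4 :* t :+ num 1)
          :* (t :^ 4 :+ num 4 :* t :^ 3 :+ num 10 :* t :^ 2 :+ num 4 :* t :+ num 1) :* up :* um
  r-den = num 2 :* p₃
  √D = con four :* (p₄ :* p₃ :* w)

heron : ∀ {n} → Polynomial n → Polynomial n → Polynomial n → Polynomial n
heron a b c = (a :+ b :+ c) :* (a :+ b :- c) :* (b :+ c :- a) :* (c :+ a :- b)

open Term

D₁≡√D² : ∀ t → D (a₁ t) (b₁ t) (c₁ t) ≡ (four * signedArea t) * (four * signedArea t)
D₁≡√D² = solve 1 (λ t → heron (a₁′ t) (b₁′ t) (c′ t) := √D t :* √D t) refl

D₂≡√D² : ∀ t → D (a₂ t) (b₂ t) (c₂ t) ≡ (four * signedArea t) * (four * signedArea t)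
D₂≡√D² = solve 1 (λ t → heron (a₂′ t) (b₂′ t) (c′ t) := √D t :* √D t) refl

abc₁*RDen≡√D*RNum : ∀ t → a₁ t * b₁ t * c₁ t * RDen t ≡ (four * signedArea t) * RNum t
abc₁*RDen≡√D*RNum = solve 1 (λ t → a₁′ t :* b₁′ t :* c′ t :* r-den t := √D t :* r-num t) refl

abc₁≡abc₂ : ∀ t → a₁ t * b₁ t * c₁ t ≡ a₂ t * b₂ t * c₂ t
abc₁≡abc₂ t = swap (P1 t) (Up t) (P2 t) (Um t) (c₁ t)
  where
  swap : ∀ p q r s c → p * q * (r * s) * c ≡ r * q * (p * s) * c
  swap = solve 5 (λ p q r s c → p :* q :* (r :* s) :* c := r :* q :* (p :* s) :* c) refl

√D≡[P4+P4]*W*RDen : ∀ t → four * signedArea t ≡ (P4 t + P4 t) * W t * RDen t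
√D≡[P4+P4]*W*RDen t = solve 3 (λ x y z → con four :* (x :* y :* z) := (x :+ x) :* z :* (num 2 :* y)) refl
                     (P4 t) (P3 t) (W t)

mainTheorem3 : (t : ℚ) →
    NondegTriangle (a₁ t) (b₁ t) (c₁ t) →
    NondegTriangle (a₂ t) (b₂ t) (c₂ t) →
    Σ[ nz ∈ RDen t ≢ 0ℚ ]
      (RationalTriangleWith (a₁ t) (b₁ t) (c₁ t) (areaExpr t) (∣ _÷_ (RNum t) (RDen t) {{≢-nonZero nz}} ∣) ×
       RationalTriangleWith (a₂ t) (b₂ t) (c₂ t) (areaExpr t) (∣ _÷_ (RNum t) (RDen t) {{≢-nonZero nz}} ∣))
mainTheorem3 t T₁ T₂ =
  RDen≢0 ,
  rationalTriangle RDen≢0 T₁ (D₁≡√D² t) (abc₁*RDen≡√D*RNum t) ,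
  rationalTriangle RDen≢0 T₂ (D₂≡√D² t)
    (trans (cong (_* RDen t) (sym (abc₁≡abc₂ t))) (abc₁*RDen≡√D*RNum t))
  where
  √D≢0 : four * signedArea t ≢ 0ℚ
  √D≢0 = 0<p*p⇒p≢0 (four * signedArea t) (subst (0ℚ <_) (D₁≡√D² t) (0<D T₁))

  RDen≢0 : RDen t ≢ 0ℚ
  RDen≢0 = p*q≢0⇒q≢0 ((P4 t + P4 t) * W t) (λ e → √D≢0 (trans (√D≡[P4+P4]*W*RDen t) e))
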